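{- Let $G=(V,E)$ be a finite graph and $e\in E$. Then $$\frac{\gamma_{coe}(G-e)+\gamma_{coe}(G/e)}{2}-1\leq \gamma_{coe}(G)\leq \frac{\gamma_{coe}(G-e)+\gamma_{coe}(G/e)}{2}+2.$$
   Context: All graphs are finite, without loops and without directed edges. For a graph $H=(V,E)$, a set $D\subseteq V$ is a dominating set if every vertex in $V\setminus D$ is adjacent to at least one vertex of $D$. A dominating set $D$ is a co-even dominating set if every vertex $u\in V\setminus D$ has even degree in $H$ (the number of edges incident to $u$). The co-even domination number $\gamma_{coe}(H)$ is the minimum cardinality of a co-even dominating set of $H$. The graph $G-e$ is obtained from $G$ by removing the edge $e$. For an edge $e$ with endpoints $u,v$, the edge contraction $G/e$ is obtained by replacing $u$ and $v$ with a single new vertex $w$, whose incident edges are exactly the edges other than $e$ that were incident with $u$ or $v$; thus $G/e$ has exactly one edge fewer than $G$. -}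

module Defs where

open import Data.Nat using (ℕ; suc; _≤_)
open import Data.Nat.Divisibility using (_∣_)
open import Data.Fin using (Fin; _≟_; punchOut)
open import Data.Fin.Subset using (Subset; _∈_; _∉_; ∣_∣)
open import Data.List using (List; length; lookup; removeAt; map; filterᵇ)
open import Data.List.Relation.Unary.Any using (Any)
open import Data.Product using (_×_; _,_; proj₁; proj₂; ∃-syntax)
open import Data.Sum using (_⊎_)
open import Data.Bool using (_∨_)
open import Relation.Nullary using (¬_; does)
open import Relation.Binary.PropositionalEquality using (_≡_; _≢_; sym)

-- A finite (multi)graph on the vertex set Fin n: a list of edges, each
-- edge given by its two endpoints (unordered; orientation is irrelevant).
-- Parallel edges are allowed (needed since contraction may create them).
Graph : ℕ → Set
Graph n = List (Fin n × Fin n)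

Edge : ∀ {n} → Graph n → Set
Edge G = Fin (length G)

Loopless : ∀ {n} → Graph n → Set
Loopless G = ∀ (k : Edge G) → proj₁ (lookup G k) ≢ proj₂ (lookup G k)

SameEnds : ∀ {n} → Fin n × Fin n → Fin n × Fin n → Set
SameEnds (a , b) (c , d) = (a ≡ c × b ≡ d) ⊎ (a ≡ d × b ≡ c)

-- No other edge is parallel to edge k (so that G/k is again loopless).
NoParallelTo : ∀ {n} (G : Graph n) → Edge G → Set
NoParallelTo G k = ∀ (k' : Edge G) → k' ≢ k → ¬ SameEnds (lookup G k') (lookup G k)

Adjacent : ∀ {n} → Graph n → Fin n → Fin n → Set
Adjacent G x y = Any (λ e → SameEnds e (x , y)) G

incident : ∀ {n} → Fin n → Fin n × Fin n → _
incident x (a , b) = does (a ≟ x) ∨ does (b ≟ x)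

degree : ∀ {n} → Graph n → Fin n → ℕ
degree G x = length (filterᵇ (incident x) G)

deleteEdge : ∀ {n} (G : Graph n) → Edge G → Graph n
deleteEdge G k = removeAt G k

-- Vertex map for contracting u v (u ≢ v) in Fin (suc m): v is identified
-- with u, and the remaining vertices are relabelled into Fin m.
mergeVertex : ∀ {m} (u v : Fin (suc m)) → v ≢ u → Fin (suc m) → Fin m
mergeVertex u v v≢u x with x ≟ v
... | Relation.Nullary.yes _ = punchOut v≢u
... | Relation.Nullary.no x≢v = punchOut {i = v} {j = x} (λ eq → x≢v (sym eq))

-- G / e : delete e, then identify its endpoints (other edges are kept,
-- so the result has exactly one edge fewer).
contract : ∀ {m} (G : Graph (suc m)) (k : Edge G) →
           proj₂ (lookup G k) ≢ proj₁ (lookup G k) → Graph m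
contract G k ne =
  map (λ e → f (proj₁ e) , f (proj₂ e)) (removeAt G k)
  where
    f = mergeVertex (proj₁ (lookup G k)) (proj₂ (lookup G k)) ne

IsCoEvenDominating : ∀ {n} → Graph n → Subset n → Set
IsCoEvenDominating G D =
  ∀ x → x ∉ D → (∃[ y ] (y ∈ D × Adjacent G x y)) × (2 ∣ degree G x)

IsCoEvenDominationNumber : ∀ {n} → Graph n → ℕ → Set
IsCoEvenDominationNumber G k =
  (∃[ D ] (IsCoEvenDominating G D × ∣ D ∣ ≡ k)) ×
  (∀ D → IsCoEvenDominating G D → k ≤ ∣ D ∣)

-- Write u, v for the ends of e and w for the merged vertex of G/e. Away from u and v the three
-- graphs G, G − e and G/e have the same degrees and, through the merge map, the same
-- adjacencies. Hence adding u and v to a co-even dominating set of G, of G − e, or to the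
-- preimage of one of G/e gives a co-even dominating set of the other graph, at a cost of at
-- most 2 vertices. Conversely the image of a co-even dominating set D of G under the merge
-- map is co-even dominating in G/e and no larger: the only new obligation is w when u, v ∉ D,
-- and then deg w = deg u + deg v − 2 is even because no edge is parallel to e. Adding the
-- resulting bounds γ(G − e) ≤ γ(G) + 2, γ(G/e) ≤ γ(G) and γ(G) ≤ γ(G − e) + 2, γ(G/e) + 2
-- in pairs gives the corollary.
module Submission where

open import Algebra.Bundles using (CommutativeMonoid)
open import Data.Bool using (Bool; true; false; _∧_; _∨_; if_then_else_)
open import Data.Bool.Properties using (∨-zeroʳ; ∨-commutativeMonoid)
open import Data.Fin using (Fin; zero; suc; _≟_; punchOut; punchIn)
open import Data.Fin.Properties
  using (suc-injective; punchOut-cong; punchOut-injective; punchIn-punchOut; punchOut-punchIn; punchInᵢ≢i)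
open import Data.Fin.Subset using (Subset; inside; outside; _∈_; _∉_; ∣_∣; _∪_; ⁅_⁆) renaming (⊥ to ∅)
open import Data.Fin.Subset.Properties using (p⊆p∪q; q⊆p∪q; x∈⁅x⁆; ∣⁅x⁆∣≡1; ∣⊥∣≡0)
open import Data.List using (List; []; _∷_; length; lookup; removeAt; map; filterᵇ)
open import Data.List.Relation.Unary.All as All using (All; []; _∷_)
open import Data.List.Relation.Unary.Any as Any using (Any; here; there)
open import Data.List.Relation.Unary.Any.Properties using (map⁺; map⁻)
open import Data.Nat using (ℕ; suc; _+_; _*_; _≤_; z≤n; s≤s)
open import Data.Nat.Divisibility using (_∣_; ∣m∣n⇒∣m+n; ∣m+n∣m⇒∣n; ∣-refl)
open import Data.Nat.Properties
  using (+-suc; +-comm; +-assoc; +-identityʳ; ≤-trans; ≤-reflexive; m≤n⇒m≤1+n; +-mono-≤; +-monoˡ-≤; +-commutativeSemigroup)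
open import Data.Nat.Tactic.RingSolver using (solve-∀)
open import Data.Product using (_×_; _,_; proj₁; proj₂; ∃-syntax)
open import Data.Sum using (_⊎_; inj₁; inj₂; [_,_])
open import Data.Vec using ([]; _∷_; insertAt) renaming (lookup to lookupᵛ; removeAt to removeAtᵛ)
open import Data.Vec.Properties
  using ([]=⇒lookup; lookup⇒[]=; insertAt-lookup; insertAt-punchIn; removeAt-punchOut; insertAt-removeAt)
open import Function using (_∘_; mk⇔)
open import Relation.Nullary using (¬_; Dec; yes; no; does; contradiction)
open import Relation.Nullary.Decidable using (dec-true; dec-false; does-⇔; _⊎-dec_; _×-dec_)
open import Relation.Binary.PropositionalEquality
  using (_≡_; _≢_; refl; sym; trans; cong; cong₂; subst; module ≡-Reasoning)
open import Algebra.Properties.CommutativeSemigroup +-commutativeSemigroup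
  using (x∙yz≈y∙xz) renaming (interchange to +-interchange)
open import Algebra.Properties.CommutativeSemigroup (CommutativeMonoid.commutativeSemigroup ∨-commutativeMonoid)
  using () renaming (interchange to ∨-interchange)
open import Defs

private
  variable
    A B : Set
    n n₁ n₂ : ℕ

bool→ℕ : Bool → ℕ
bool→ℕ true  = 1
bool→ℕ false = 0

bool→ℕ-∨ : ∀ x y → x ∧ y ≡ false → bool→ℕ (x ∨ y) ≡ bool→ℕ x + bool→ℕ y
bool→ℕ-∨ true  false _ = refl
bool→ℕ-∨ false y     _ = refl

count : (A → Bool) → List A → ℕ
count p xs = length (filterᵇ p xs)

count-∷ : ∀ (p : A → Bool) x xs → count p (x ∷ xs) ≡ bool→ℕ (p x) + count p xs
count-∷ p x xs with p x
... | true  = refl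
... | false = refl

count-removeAt : ∀ (p : A → Bool) xs k →
                 count p xs ≡ bool→ℕ (p (lookup xs k)) + count p (removeAt xs k)
count-removeAt p (x ∷ xs) zero    = count-∷ p x xs
count-removeAt p (x ∷ xs) (suc k) = begin
  count p (x ∷ xs)                                         ≡⟨ count-∷ p x xs ⟩
  [x] + count p xs                                         ≡⟨ cong ([x] +_) (count-removeAt p xs k) ⟩
  [x] + ([xₖ] + count p (removeAt xs k))                   ≡⟨ x∙yz≈y∙xz [x] [xₖ] _ ⟩
  [xₖ] + ([x] + count p (removeAt xs k))                   ≡⟨ cong ([xₖ] +_) (count-∷ p x (removeAt xs k)) ⟨
  [xₖ] + count p (x ∷ removeAt xs k)                       ∎
  where
  open ≡-Reasoning
  [x] = bool→ℕ (p x)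
  [xₖ] = bool→ℕ (p (lookup xs k))

count-map : ∀ (p : B → Bool) (g : A → B) xs → count p (map g xs) ≡ count (p ∘ g) xs
count-map p g []       = refl
count-map p g (x ∷ xs) = begin
  count p (g x ∷ map g xs)              ≡⟨ count-∷ p (g x) (map g xs) ⟩
  bool→ℕ (p (g x)) + count p (map g xs) ≡⟨ cong (bool→ℕ (p (g x)) +_) (count-map p g xs) ⟩
  bool→ℕ (p (g x)) + count (p ∘ g) xs   ≡⟨ count-∷ (p ∘ g) x xs ⟨
  count (p ∘ g) (x ∷ xs)                ∎
  where open ≡-Reasoning

count-cong : ∀ (p q : A → Bool) {xs} → All (λ x → p x ≡ q x) xs → count p xs ≡ count q xs
count-cong p q []                        = refl
count-cong p q {x ∷ xs} (px≡qx ∷ p≗q) = begin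
  count p (x ∷ xs)          ≡⟨ count-∷ p x xs ⟩
  bool→ℕ (p x) + count p xs ≡⟨ cong₂ _+_ (cong bool→ℕ px≡qx) (count-cong p q p≗q) ⟩
  bool→ℕ (q x) + count q xs ≡⟨ count-∷ q x xs ⟨
  count q (x ∷ xs)          ∎
  where open ≡-Reasoning

count-∨ : ∀ (p q : A → Bool) {xs} → All (λ x → p x ∧ q x ≡ false) xs →
          count (λ x → p x ∨ q x) xs ≡ count p xs + count q xs
count-∨ p q []                    = refl
count-∨ p q {x ∷ xs} (disj ∷ disjs) = begin
  count (λ x → p x ∨ q x) (x ∷ xs)                          ≡⟨ count-∷ (λ x → p x ∨ q x) x xs ⟩
  bool→ℕ (p x ∨ q x) + count (λ x → p x ∨ q x) xs           ≡⟨ cong₂ _+_ (bool→ℕ-∨ (p x) (q x) disj) (count-∨ p q disjs) ⟩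
  (bool→ℕ (p x) + bool→ℕ (q x)) + (count p xs + count q xs) ≡⟨ +-interchange (bool→ℕ (p x)) _ _ _ ⟩
  (bool→ℕ (p x) + count p xs) + (bool→ℕ (q x) + count q xs) ≡⟨ cong₂ _+_ (count-∷ p x xs) (count-∷ q x xs) ⟨
  count p (x ∷ xs) + count q (x ∷ xs)                       ∎
  where open ≡-Reasoning

Any-∃⁻ : ∀ {R : B → Set} {P : B → A → Set} {xs} →
         Any (λ x → ∃[ b ] (R b × P b x)) xs → ∃[ b ] (R b × Any (P b) xs)
Any-∃⁻ (here (b , rb , pbx)) = b , rb , here pbx
Any-∃⁻ (there any) with b , rb , pbxs ← Any-∃⁻ any = b , rb , there pbxs

module _ {P : A → Set} where

  Any-removeAt⁻ : ∀ xs k → Any P (removeAt xs k) → Any P xs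
  Any-removeAt⁻ (x ∷ xs) zero    any        = there any
  Any-removeAt⁻ (x ∷ xs) (suc k) (here px)  = here px
  Any-removeAt⁻ (x ∷ xs) (suc k) (there any) = there (Any-removeAt⁻ xs k any)

  Any-removeAt⁺ : ∀ xs k → ¬ P (lookup xs k) → Any P xs → Any P (removeAt xs k)
  Any-removeAt⁺ (x ∷ xs) zero    ¬px (here px)  = contradiction px ¬px
  Any-removeAt⁺ (x ∷ xs) zero    ¬px (there any) = any
  Any-removeAt⁺ (x ∷ xs) (suc k) ¬px (here px)  = here px
  Any-removeAt⁺ (x ∷ xs) (suc k) ¬px (there any) = there (Any-removeAt⁺ xs k ¬px any)

  All-lookup⁺ : ∀ xs → (∀ i → P (lookup xs i)) → All P xs
  All-lookup⁺ []       _ = []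
  All-lookup⁺ (x ∷ xs) h = h zero ∷ All-lookup⁺ xs (h ∘ suc)

  All-removeAt⁺ : ∀ xs k → (∀ k′ → k′ ≢ k → P (lookup xs k′)) → All P (removeAt xs k)
  All-removeAt⁺ (x ∷ xs) zero    h = All-lookup⁺ xs (λ i → h (suc i) λ ())
  All-removeAt⁺ (x ∷ xs) (suc k) h =
    h zero (λ ()) ∷ All-removeAt⁺ xs k (λ k′ k′≢k → h (suc k′) (k′≢k ∘ suc-injective))

∣p∪q∣≤∣p∣+∣q∣ : ∀ (p q : Subset n) → ∣ p ∪ q ∣ ≤ ∣ p ∣ + ∣ q ∣
∣p∪q∣≤∣p∣+∣q∣ []           []           = z≤n
∣p∪q∣≤∣p∣+∣q∣ (inside ∷ p)  (inside ∷ q)  =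
  s≤s (≤-trans (m≤n⇒m≤1+n (∣p∪q∣≤∣p∣+∣q∣ p q)) (≤-reflexive (sym (+-suc ∣ p ∣ ∣ q ∣))))
∣p∪q∣≤∣p∣+∣q∣ (inside ∷ p)  (outside ∷ q) = s≤s (∣p∪q∣≤∣p∣+∣q∣ p q)
∣p∪q∣≤∣p∣+∣q∣ (outside ∷ p) (inside ∷ q)  =
  ≤-trans (s≤s (∣p∪q∣≤∣p∣+∣q∣ p q)) (≤-reflexive (sym (+-suc ∣ p ∣ ∣ q ∣)))
∣p∪q∣≤∣p∣+∣q∣ (outside ∷ p) (outside ∷ q) = ∣p∪q∣≤∣p∣+∣q∣ p q

∣p∪⁅x⁆∣≤∣p∣+1 : ∀ (p : Subset n) x → ∣ p ∪ ⁅ x ⁆ ∣ ≤ ∣ p ∣ + 1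
∣p∪⁅x⁆∣≤∣p∣+1 p x = ≤-trans (∣p∪q∣≤∣p∣+∣q∣ p ⁅ x ⁆) (≤-reflexive (cong (∣ p ∣ +_) (∣⁅x⁆∣≡1 x)))

x∉p∪⁅y⁆⁻ : ∀ {p : Subset n} {x y} → x ∉ p ∪ ⁅ y ⁆ → x ∉ p × x ≢ y
x∉p∪⁅y⁆⁻ {p = p} {y = y} x∉ = x∉ ∘ p⊆p∪q ⁅ y ⁆ , λ { refl → x∉ (q⊆p∪q p ⁅ y ⁆ (x∈⁅x⁆ y)) }

∣insertAt∣ : ∀ (p : Subset n) i b → ∣ insertAt p i b ∣ ≡ bool→ℕ b + ∣ p ∣
∣insertAt∣ p             zero    inside  = refl
∣insertAt∣ p             zero    outside = refl
∣insertAt∣ (inside ∷ p)  (suc i) b       = trans (cong suc (∣insertAt∣ p i b)) (sym (+-suc (bool→ℕ b) ∣ p ∣))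
∣insertAt∣ (outside ∷ p) (suc i) b       = ∣insertAt∣ p i b

i∈insertAt[i] : ∀ (p : Subset n) i → i ∈ insertAt p i inside
i∈insertAt[i] p i = lookup⇒[]= i _ (insertAt-lookup p i inside)

punchIn∈insertAt : ∀ {p : Subset n} i b {j} → j ∈ p → punchIn i j ∈ insertAt p i b
punchIn∈insertAt {p = p} i b {j} j∈p =
  lookup⇒[]= (punchIn i j) _ (trans (insertAt-punchIn p i b j) ([]=⇒lookup j∈p))

∈-removeAt⁺ : ∀ {p : Subset (suc n)} i {j} → punchIn i j ∈ p → j ∈ removeAtᵛ p i
∈-removeAt⁺ {p = p} i {j} punchIn∈p = lookup⇒[]= j _ (begin
  lookupᵛ (removeAtᵛ p i) j                     ≡⟨ cong (lookupᵛ (removeAtᵛ p i)) (punchOut-punchIn i) ⟨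
  lookupᵛ (removeAtᵛ p i) (punchOut i≢punchIn)  ≡⟨ removeAt-punchOut p i≢punchIn ⟩
  lookupᵛ p (punchIn i j)                       ≡⟨ []=⇒lookup punchIn∈p ⟩
  inside                                        ∎)
  where
  open ≡-Reasoning
  i≢punchIn : i ≢ punchIn i j
  i≢punchIn = punchInᵢ≢i i j ∘ sym

SameEnds-map : ∀ (h : Fin n₁ → Fin n₂) {p q} → SameEnds p q →
               SameEnds (h (proj₁ p) , h (proj₂ p)) (h (proj₁ q) , h (proj₂ q))
SameEnds-map h (inj₁ (a≡c , b≡d)) = inj₁ (cong h a≡c , cong h b≡d)
SameEnds-map h (inj₂ (a≡d , b≡c)) = inj₂ (cong h a≡d , cong h b≡c)

≢-ends⇒¬SameEnds : ∀ {u v x y : Fin n} → x ≢ u → x ≢ v → ¬ SameEnds (u , v) (x , y)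
≢-ends⇒¬SameEnds x≢u x≢v (inj₁ (u≡x , _)) = x≢u (sym u≡x)
≢-ends⇒¬SameEnds x≢u x≢v (inj₂ (_ , v≡x)) = x≢v (sym v≡x)

incident∧incident≡false : ∀ {u v : Fin n} → v ≢ u → ∀ p → ¬ SameEnds p (u , v) →
                          incident u p ∧ incident v p ≡ false
incident∧incident≡false {u = u} {v} v≢u (a , b) ¬same =
  dec-false (((a ≟ u) ⊎-dec (b ≟ u)) ×-dec ((a ≟ v) ⊎-dec (b ≟ v))) ends
  where
  ends : ¬ ((a ≡ u ⊎ b ≡ u) × (a ≡ v ⊎ b ≡ v))
  ends (inj₁ refl , inj₁ refl) = v≢u refl
  ends (inj₁ refl , inj₂ refl) = ¬same (inj₁ (refl , refl))
  ends (inj₂ refl , inj₁ refl) = ¬same (inj₂ (refl , refl))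
  ends (inj₂ refl , inj₂ refl) = v≢u refl

CoEvenTransfer : Graph n₁ → Graph n₂ → ℕ → Set
CoEvenTransfer H₁ H₂ k =
  ∀ D → IsCoEvenDominating H₁ D → ∃[ D′ ] (IsCoEvenDominating H₂ D′ × ∣ D′ ∣ ≤ ∣ D ∣ + k)

coEvenDominationNumber-≤ : ∀ {H₁ : Graph n₁} {H₂ : Graph n₂} {k a b} → CoEvenTransfer H₁ H₂ k →
                           IsCoEvenDominationNumber H₁ a → IsCoEvenDominationNumber H₂ b → b ≤ a + k
coEvenDominationNumber-≤ {k = k} transfer ((D , D-dom , ∣D∣≡a) , _) (_ , minimal)
  with D′ , D′-dom , ∣D′∣≤ ← transfer D D-dom =
  ≤-trans (minimal D′ D′-dom) (subst (λ t → ∣ D′ ∣ ≤ t + k) ∣D∣≡a ∣D′∣≤)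

coEvenTransfer-addPair : ∀ {H₁ H₂ : Graph n} (u v : Fin n) →
                         (∀ {x} → x ≢ u → x ≢ v → degree H₁ x ≡ degree H₂ x) →
                         (∀ {x y} → x ≢ u → x ≢ v → Adjacent H₁ x y → Adjacent H₂ x y) →
                         CoEvenTransfer H₁ H₂ 2
coEvenTransfer-addPair u v same-degree adjacent⁺ D D-dom = (D ∪ ⁅ u ⁆) ∪ ⁅ v ⁆ , dom , card
  where
  dom : IsCoEvenDominating _ ((D ∪ ⁅ u ⁆) ∪ ⁅ v ⁆)
  dom x x∉ =
    let x∉D∪u , x≢v = x∉p∪⁅y⁆⁻ x∉
        x∉D , x≢u = x∉p∪⁅y⁆⁻ x∉D∪u
        (y , y∈D , adj) , even = D-dom x x∉D
    in (y , p⊆p∪q ⁅ v ⁆ (p⊆p∪q ⁅ u ⁆ y∈D) , adjacent⁺ x≢u x≢v adj) , subst (2 ∣_) (same-degree x≢u x≢v) even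
  card : ∣ (D ∪ ⁅ u ⁆) ∪ ⁅ v ⁆ ∣ ≤ ∣ D ∣ + 2
  card = ≤-trans (∣p∪⁅x⁆∣≤∣p∣+1 (D ∪ ⁅ u ⁆) v)
           (≤-trans (+-monoˡ-≤ 1 (∣p∪⁅x⁆∣≤∣p∣+1 D u)) (≤-reflexive (+-assoc ∣ D ∣ 1 1)))

module MergeVertex {m} (u v : Fin (suc m)) (v≢u : v ≢ u) where

  private
    f : Fin (suc m) → Fin m
    f = mergeVertex u v v≢u

  merge-≢v : ∀ {x} (x≢v : x ≢ v) → f x ≡ punchOut (x≢v ∘ sym)
  merge-≢v {x} x≢v with x ≟ v
  ... | yes x≡v = contradiction x≡v x≢v
  ... | no _    = punchOut-cong v refl

  merge-v≡merge-u : f v ≡ f u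
  merge-v≡merge-u with v ≟ v
  ... | yes _   = sym (trans (merge-≢v (v≢u ∘ sym)) (punchOut-cong v refl))
  ... | no v≢v  = contradiction refl v≢v

  merge-punchIn : ∀ y → f (punchIn v y) ≡ y
  merge-punchIn y = trans (merge-≢v (punchInᵢ≢i v y)) (trans (punchOut-cong v refl) (punchOut-punchIn v))

  punchIn-merge : ∀ {x} → x ≢ v → punchIn v (f x) ≡ x
  punchIn-merge x≢v = trans (cong (punchIn v) (merge-≢v x≢v)) (punchIn-punchOut _)

  merge-injective : ∀ {x y} → x ≢ v → y ≢ v → f x ≡ f y → x ≡ y
  merge-injective x≢v y≢v fx≡fy =
    punchOut-injective (x≢v ∘ sym) (y≢v ∘ sym) (trans (sym (merge-≢v x≢v)) (trans fx≡fy (merge-≢v y≢v)))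

  merge≡merge-u⁻ : ∀ {x} → f x ≡ f u → x ≡ u ⊎ x ≡ v
  -- Casing on a separate Dec: a `with x ≟ v` would also abstract the test inside f x.
  merge≡merge-u⁻ {x} fx≡fu = by-cases (x ≟ v)
    where
    by-cases : Dec (x ≡ v) → x ≡ u ⊎ x ≡ v
    by-cases (yes x≡v) = inj₂ x≡v
    by-cases (no x≢v)  = inj₁ (merge-injective x≢v (v≢u ∘ sym) fx≡fu)

  merge≡merge⁻ : ∀ {a x} → x ≢ u → x ≢ v → f a ≡ f x → a ≡ x
  merge≡merge⁻ {a} {x} x≢u x≢v fa≡fx = by-cases (a ≟ v)
    where
    by-cases : Dec (a ≡ v) → a ≡ x
    by-cases (no a≢v)  = merge-injective a≢v x≢v fa≡fx
    by-cases (yes refl) with merge≡merge-u⁻ (trans (sym fa≡fx) merge-v≡merge-u)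
    ... | inj₁ x≡u = contradiction x≡u x≢u
    ... | inj₂ x≡v = contradiction x≡v x≢v

  merge-≟ : ∀ a {x} → x ≢ u → x ≢ v → does (f a ≟ f x) ≡ does (a ≟ x)
  merge-≟ a x≢u x≢v = does-⇔ (mk⇔ (merge≡merge⁻ x≢u x≢v) (cong f)) (f a ≟ _) (a ≟ _)

  merge-≟-u : ∀ a → does (f a ≟ f u) ≡ does (a ≟ u) ∨ does (a ≟ v)
  merge-≟-u a = does-⇔ (mk⇔ merge≡merge-u⁻ [ cong f , (λ{ refl → merge-v≡merge-u }) ])
                       (f a ≟ f u) ((a ≟ u) ⊎-dec (a ≟ v))

  SameEnds-merge⁻ : ∀ {a b x z} → x ≢ u → x ≢ v → SameEnds (f a , f b) (f x , z) →
                    ∃[ y ] (f y ≡ z × SameEnds (a , b) (x , y))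
  SameEnds-merge⁻ {a} {b} x≢u x≢v (inj₁ (fa≡fx , fb≡z)) = b , fb≡z , inj₁ (merge≡merge⁻ x≢u x≢v fa≡fx , refl)
  SameEnds-merge⁻ {a} {b} x≢u x≢v (inj₂ (fa≡z , fb≡fx)) = a , fa≡z , inj₂ (refl , merge≡merge⁻ x≢u x≢v fb≡fx)

  merge∈⇒∈insertAt : ∀ {D : Subset m} {y} → f y ∈ D → y ∈ insertAt D v inside
  merge∈⇒∈insertAt {D} {y} fy∈D = by-cases (y ≟ v)
    where
    by-cases : Dec (y ≡ v) → y ∈ insertAt D v inside
    by-cases (yes refl) = i∈insertAt[i] D v
    by-cases (no y≢v)   = subst (_∈ insertAt D v inside) (punchIn-merge y≢v) (punchIn∈insertAt v inside fy∈D)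

  mergeSubset : Subset (suc m) → Subset m
  mergeSubset D = removeAtᵛ D v ∪ (if lookupᵛ D v then ⁅ f v ⁆ else ∅)

  ∣mergeSubset∣≤∣D∣ : ∀ D → ∣ mergeSubset D ∣ ≤ ∣ D ∣
  ∣mergeSubset∣≤∣D∣ D = ≤-trans (∣p∪q∣≤∣p∣+∣q∣ (removeAtᵛ D v) _) (≤-reflexive (begin
    ∣ removeAtᵛ D v ∣ + ∣ if lookupᵛ D v then ⁅ f v ⁆ else ∅ ∣ ≡⟨ cong (∣ removeAtᵛ D v ∣ +_) (∣if⁅fv⁆∣ (lookupᵛ D v)) ⟩
    ∣ removeAtᵛ D v ∣ + bool→ℕ (lookupᵛ D v)                 ≡⟨ +-comm ∣ removeAtᵛ D v ∣ _ ⟩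
    bool→ℕ (lookupᵛ D v) + ∣ removeAtᵛ D v ∣                 ≡⟨ ∣insertAt∣ (removeAtᵛ D v) v (lookupᵛ D v) ⟨
    ∣ insertAt (removeAtᵛ D v) v (lookupᵛ D v) ∣             ≡⟨ cong ∣_∣ (insertAt-removeAt D v) ⟩
    ∣ D ∣                                                   ∎))
    where
    open ≡-Reasoning
    ∣if⁅fv⁆∣ : ∀ b → ∣ if b then ⁅ f v ⁆ else ∅ ∣ ≡ bool→ℕ b
    ∣if⁅fv⁆∣ true  = ∣⁅x⁆∣≡1 (f v)
    ∣if⁅fv⁆∣ false = ∣⊥∣≡0 m

  punchIn∈⇒∈mergeSubset : ∀ {D y} → punchIn v y ∈ D → y ∈ mergeSubset D
  punchIn∈⇒∈mergeSubset punchIn∈D = p⊆p∪q _ (∈-removeAt⁺ v punchIn∈D)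

  ∈⇒merge∈mergeSubset : ∀ {D z} → z ∈ D → f z ∈ mergeSubset D
  ∈⇒merge∈mergeSubset {D} {z} z∈D = by-cases (z ≟ v)
    where
    by-cases : Dec (z ≡ v) → f z ∈ mergeSubset D
    by-cases (yes refl) = q⊆p∪q (removeAtᵛ D v) _
      (subst (λ b → f v ∈ (if b then ⁅ f v ⁆ else ∅)) (sym ([]=⇒lookup z∈D)) (x∈⁅x⁆ (f v)))
    by-cases (no z≢v)   = punchIn∈⇒∈mergeSubset (subst (_∈ D) (sym (punchIn-merge z≢v)) z∈D)

module EdgeOperations {m} (G : Graph (suc m)) (e : Edge G)
                      (v≢u : proj₂ (lookup G e) ≢ proj₁ (lookup G e)) where

  private
    u v : Fin (suc m)
    u = proj₁ (lookup G e)
    v = proj₂ (lookup G e)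

    f : Fin (suc m) → Fin m
    f = mergeVertex u v v≢u

    merge² : Fin (suc m) × Fin (suc m) → Fin m × Fin m
    merge² p = f (proj₁ p) , f (proj₂ p)

    G-e : Graph (suc m)
    G-e = deleteEdge G e

    G/e : Graph m
    G/e = contract G e v≢u

  open MergeVertex u v v≢u

  degree-deleteEdge : ∀ {x} → x ≢ u → x ≢ v → degree G-e x ≡ degree G x
  degree-deleteEdge {x} x≢u x≢v = sym (begin
    degree G x                                        ≡⟨ count-removeAt (incident x) G e ⟩
    bool→ℕ (incident x (lookup G e)) + degree G-e x   ≡⟨ cong (λ b → bool→ℕ b + degree G-e x) e-not-incident ⟩
    degree G-e x                                      ∎)
    where
    open ≡-Reasoning
    e-not-incident : incident x (lookup G e) ≡ false
    e-not-incident = cong₂ _∨_ (dec-false (u ≟ x) (x≢u ∘ sym)) (dec-false (v ≟ x) (x≢v ∘ sym))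

  degree-contract : ∀ {x} → x ≢ u → x ≢ v → degree G/e (f x) ≡ degree G x
  degree-contract {x} x≢u x≢v = begin
    degree G/e (f x)                               ≡⟨ count-map (incident (f x)) merge² (removeAt G e) ⟩
    count (incident (f x) ∘ merge²) (removeAt G e) ≡⟨ count-cong _ _ {removeAt G e} (All.universal merge-incident _) ⟩
    degree G-e x                                   ≡⟨ degree-deleteEdge x≢u x≢v ⟩
    degree G x                                     ∎
    where
    open ≡-Reasoning
    merge-incident : ∀ p → incident (f x) (merge² p) ≡ incident x p
    merge-incident (a , b) = cong₂ _∨_ (merge-≟ a x≢u x≢v) (merge-≟ b x≢u x≢v)

  degree-contract-merged : NoParallelTo G e → degree G u + degree G v ≡ 2 + degree G/e (f u)
  degree-contract-merged noParallel = begin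
    degree G u + degree G v
      ≡⟨ cong₂ _+_ (count-removeAt (incident u) G e) (count-removeAt (incident v) G e) ⟩
    (bool→ℕ (incident u (u , v)) + dᵤ) + (bool→ℕ (incident v (u , v)) + dᵥ)
      ≡⟨ cong₂ (λ s t → (bool→ℕ s + dᵤ) + (bool→ℕ t + dᵥ))
               (cong (_∨ does (v ≟ u)) (dec-true (u ≟ u) refl))
               (trans (cong (does (u ≟ v) ∨_) (dec-true (v ≟ v) refl)) (∨-zeroʳ _)) ⟩
    suc dᵤ + suc dᵥ
      ≡⟨ cong suc (+-suc dᵤ dᵥ) ⟩
    2 + (dᵤ + dᵥ)
      ≡⟨ cong (2 +_) (count-∨ (incident u) (incident v) disjoint) ⟨
    2 + count (λ p → incident u p ∨ incident v p) (removeAt G e)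
      ≡⟨ cong (2 +_) (count-cong _ _ {removeAt G e} (All.universal merge-incident _)) ⟨
    2 + count (incident (f u) ∘ merge²) (removeAt G e)
      ≡⟨ cong (2 +_) (count-map (incident (f u)) merge² (removeAt G e)) ⟨
    2 + degree G/e (f u)
      ∎
    where
    open ≡-Reasoning
    dᵤ = count (incident u) (removeAt G e)
    dᵥ = count (incident v) (removeAt G e)
    disjoint : All (λ p → incident u p ∧ incident v p ≡ false) (removeAt G e)
    disjoint = All-removeAt⁺ G e (λ k k≢e → incident∧incident≡false v≢u (lookup G k) (noParallel k k≢e))
    merge-incident : ∀ p → incident (f u) (merge² p) ≡ incident u p ∨ incident v p
    merge-incident (a , b) = trans (cong₂ _∨_ (merge-≟-u a) (merge-≟-u b)) (∨-interchange (does (a ≟ u)) (does (a ≟ v)) _ _)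

  even-contract-merged : NoParallelTo G e → 2 ∣ degree G u → 2 ∣ degree G v → 2 ∣ degree G/e (f u)
  even-contract-merged noParallel 2∣dᵤ 2∣dᵥ =
    ∣m+n∣m⇒∣n (subst (2 ∣_) (degree-contract-merged noParallel) (∣m∣n⇒∣m+n 2∣dᵤ 2∣dᵥ)) ∣-refl

  Adjacent-deleteEdge⁻ : ∀ {x y} → Adjacent G-e x y → Adjacent G x y
  Adjacent-deleteEdge⁻ = Any-removeAt⁻ G e

  Adjacent-deleteEdge⁺ : ∀ {x y} → ¬ SameEnds (u , v) (x , y) → Adjacent G x y → Adjacent G-e x y
  Adjacent-deleteEdge⁺ = Any-removeAt⁺ G e

  Adjacent-contract⁺ : ∀ {x y} → ¬ SameEnds (u , v) (x , y) → Adjacent G x y → Adjacent G/e (f x) (f y)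
  Adjacent-contract⁺ ¬e adj = map⁺ (Any.map (SameEnds-map f) (Adjacent-deleteEdge⁺ ¬e adj))

  Adjacent-contract⁻ : ∀ {x z} → x ≢ u → x ≢ v → Adjacent G/e (f x) z → ∃[ y ] (f y ≡ z × Adjacent G x y)
  Adjacent-contract⁻ x≢u x≢v adj =
    Any-∃⁻ (Any.map (SameEnds-merge⁻ x≢u x≢v) (Any-removeAt⁻ G e (map⁻ adj)))

  coEvenTransfer-deleteEdge : CoEvenTransfer G G-e 2
  coEvenTransfer-deleteEdge = coEvenTransfer-addPair u v
    (λ x≢u x≢v → sym (degree-deleteEdge x≢u x≢v))
    (λ x≢u x≢v → Adjacent-deleteEdge⁺ (≢-ends⇒¬SameEnds x≢u x≢v))

  coEvenTransfer-undeleteEdge : CoEvenTransfer G-e G 2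
  coEvenTransfer-undeleteEdge = coEvenTransfer-addPair u v degree-deleteEdge (λ _ _ → Adjacent-deleteEdge⁻)

  coEvenTransfer-uncontract : CoEvenTransfer G/e G 2
  coEvenTransfer-uncontract D D-dom = insertAt D v inside ∪ ⁅ u ⁆ , dom , card
    where
    dom : IsCoEvenDominating G (insertAt D v inside ∪ ⁅ u ⁆)
    dom x x∉ =
      let x∉I , x≢u = x∉p∪⁅y⁆⁻ x∉
          x≢v : x ≢ v
          x≢v = λ x≡v → x∉I (subst (_∈ insertAt D v inside) (sym x≡v) (i∈insertAt[i] D v))
          (z , z∈D , adj) , even = D-dom (f x) (x∉I ∘ merge∈⇒∈insertAt)
          y , fy≡z , adjᴳ = Adjacent-contract⁻ x≢u x≢v adj
      in (y , p⊆p∪q ⁅ u ⁆ (merge∈⇒∈insertAt (subst (_∈ D) (sym fy≡z) z∈D)) , adjᴳ) ,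
         subst (2 ∣_) (degree-contract x≢u x≢v) even
    card : ∣ insertAt D v inside ∪ ⁅ u ⁆ ∣ ≤ ∣ D ∣ + 2
    card = ≤-trans (∣p∪⁅x⁆∣≤∣p∣+1 (insertAt D v inside) u)
             (≤-reflexive (trans (cong (_+ 1) (∣insertAt∣ D v inside)) (sym (+-suc ∣ D ∣ 1))))

  coEvenTransfer-contract : NoParallelTo G e → CoEvenTransfer G G/e 0
  coEvenTransfer-contract noParallel D D-dom =
    mergeSubset D , dom , ≤-trans (∣mergeSubset∣≤∣D∣ D) (≤-reflexive (sym (+-identityʳ ∣ D ∣)))
    where
    Dominated : Fin m → Set
    Dominated y = (∃[ z ] (z ∈ mergeSubset D × Adjacent G/e y z)) × (2 ∣ degree G/e y)

    dominated : ∀ x → x ≢ v → x ∉ D → f x ∉ mergeSubset D → Dominated (f x)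
    dominated x x≢v x∉D fx∉ with x ≟ u
    ... | no x≢u =
      let (z , z∈D , adj) , even = D-dom x x∉D
      in (f z , ∈⇒merge∈mergeSubset z∈D , Adjacent-contract⁺ (≢-ends⇒¬SameEnds x≢u x≢v) adj) ,
         subst (2 ∣_) (sym (degree-contract x≢u x≢v)) even
    ... | yes refl =
      let v∉D : v ∉ D
          v∉D = λ v∈D → fx∉ (subst (_∈ mergeSubset D) merge-v≡merge-u (∈⇒merge∈mergeSubset v∈D))
          (z , z∈D , adj) , evenᵤ = D-dom u x∉D
          _ , evenᵥ = D-dom v v∉D
          ¬e : ¬ SameEnds (u , v) (u , z)
          ¬e = λ { (inj₁ (_ , v≡z)) → v∉D (subst (_∈ D) (sym v≡z) z∈D) ; (inj₂ (_ , v≡u)) → v≢u v≡u }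
      in (f z , ∈⇒merge∈mergeSubset z∈D , Adjacent-contract⁺ ¬e adj) ,
         even-contract-merged noParallel evenᵤ evenᵥ

    dom : IsCoEvenDominating G/e (mergeSubset D)
    dom y y∉ = subst Dominated (merge-punchIn y)
      (dominated (punchIn v y) (punchInᵢ≢i v y) (y∉ ∘ punchIn∈⇒∈mergeSubset)
                 (y∉ ∘ subst (_∈ mergeSubset D) (merge-punchIn y)))

corollary3p7 : ∀ {m} (G : Graph (suc m)) (loopless : Loopless G) (e : Edge G) →
    NoParallelTo G e →
    (a b c : ℕ) →
    IsCoEvenDominationNumber G a →
    IsCoEvenDominationNumber (deleteEdge G e) b →
    IsCoEvenDominationNumber (contract G e (λ eq → loopless e (sym eq))) c →
    (b + c ≤ 2 * a + 2) × (2 * a ≤ b + c + 4)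
corollary3p7 G loopless e noParallel a b c γ-G γ-G-e γ-G/e =
  ≤-trans (+-mono-≤ b≤a+2 c≤a+0) (≤-reflexive (upper-identity a)) ,
  ≤-trans (≤-reflexive (lower-identity a)) (≤-trans (+-mono-≤ a≤b+2 a≤c+2) (≤-reflexive (sum-identity b c)))
  where
  open EdgeOperations G e (λ eq → loopless e (sym eq))
  b≤a+2 : b ≤ a + 2
  b≤a+2 = coEvenDominationNumber-≤ coEvenTransfer-deleteEdge γ-G γ-G-e
  c≤a+0 : c ≤ a + 0
  c≤a+0 = coEvenDominationNumber-≤ (coEvenTransfer-contract noParallel) γ-G γ-G/e
  a≤b+2 : a ≤ b + 2
  a≤b+2 = coEvenDominationNumber-≤ coEvenTransfer-undeleteEdge γ-G-e γ-G
  a≤c+2 : a ≤ c + 2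
  a≤c+2 = coEvenDominationNumber-≤ coEvenTransfer-uncontract γ-G/e γ-G
  upper-identity : ∀ a → (a + 2) + (a + 0) ≡ 2 * a + 2
  upper-identity = solve-∀
  lower-identity : ∀ a → 2 * a ≡ a + a
  lower-identity = solve-∀
  sum-identity : ∀ b c → (b + 2) + (c + 2) ≡ b + c + 4
  sum-identity = solve-∀
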